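{- Fix $s\ge 0$. Then for every integer $k$ with $0\le k\le 3s$, $$v(sJ)=\sum_{\substack{M\in M(3),\ \rho(M)=k\\ \max(M)\le s}} v(M)\,v(sJ-M).$$
   Context: A semi-magic square of size 3 is a $3\times 3$ matrix with non-negative integer entries whose row sums and column sums all equal a common value $\rho(M)$ (the line sum); $M(3)$ is the set of all of them, $\max(M)$ denotes the largest entry of $M$, and $J$ is the all-ones matrix. A lattice path from $0$ to $M$ is a sequence $0=M_0,\dots,M_{\rho(M)}=M$ with each $M_i-M_{i-1}$ a $3\times3$ permutation matrix; $v(M)$ is the number of such paths. -}

module Defs where

open import Data.Nat using (ℕ; zero; suc; _+_; _*_; _∸_; _≤_; _⊔_)
open import Data.Nat.Properties using (_≟_; _≤?_)
open import Data.Fin using (Fin; combine; zero; suc)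
open import Data.Fin.Properties using (all?)
open import Data.Vec using (Vec; []; _∷_; lookup)
open import Data.List using (List; []; _∷_; [_]; map; concatMap; filter; length; upTo; foldr)
open import Data.Nat.ListAction using (sum)
open import Data.Product using (_×_; _,_; proj₁; proj₂)
open import Relation.Nullary.Decidable using (Dec; _×-dec_)
open import Relation.Unary using (Decidable)
open import Relation.Binary.PropositionalEquality using (_≡_)

Mat : Set
Mat = Fin 3 → Fin 3 → ℕ

rowSum : Mat → Fin 3 → ℕ
rowSum M i = M i zero + M i (suc zero) + M i (suc (suc zero))

colSum : Mat → Fin 3 → ℕ
colSum M j = M zero j + M (suc zero) j + M (suc (suc zero)) j

SemiMagicWith : ℕ → Mat → Set
SemiMagicWith k M = (∀ i → rowSum M i ≡ k) × (∀ j → colSum M j ≡ k)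

semiMagicWith? : (k : ℕ) → Decidable (SemiMagicWith k)
semiMagicWith? k M = all? (λ i → rowSum M i ≟ k) ×-dec all? (λ j → colSum M j ≟ k)

-- line sum ρ(M) (row sum of the first row; equals every line sum for M ∈ M(3))
ρ : Mat → ℕ
ρ M = rowSum M zero

maxEntry : Mat → ℕ
maxEntry M = foldr (λ p acc → M (proj₁ p) (proj₂ p) ⊔ acc) 0 cells
  where
  idx : List (Fin 3)
  idx = zero ∷ suc zero ∷ suc (suc zero) ∷ []
  cells : List (Fin 3 × Fin 3)
  cells = concatMap (λ i → map (λ j → i , j) idx) idx

vecs : ℕ → (n : ℕ) → List (Vec ℕ n)
vecs b zero = [ [] ]
vecs b (suc n) = concatMap (λ x → map (x ∷_) (vecs b n)) (upTo b)

toMat : Vec ℕ 9 → Mat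
toMat v i j = lookup v (combine i j)

-- all 3×3 matrices with entries in {0,…,b-1} (each exactly once)
matsBelow : ℕ → List Mat
matsBelow b = map toMat (vecs b 9)

-- permutation matrices: 0/1 matrices with every row and column sum equal to 1
PermMat : Mat → Set
PermMat = SemiMagicWith 1

permMats : List Mat
permMats = filter (semiMagicWith? 1) (matsBelow 2)

zeroMat : Mat
zeroMat i j = 0

_⊕_ : Mat → Mat → Mat
(M ⊕ N) i j = M i j + N i j

_⊖_ : Mat → Mat → Mat
(M ⊖ N) i j = M i j ∸ N i j

sJ : ℕ → Mat
sJ s i j = s

MatEq : Mat → Mat → Set
MatEq M N = ∀ i j → M i j ≡ N i j

matEq? : (N : Mat) → Decidable (MatEq N)
matEq? N M = all? (λ i → all? (λ j → N i j ≟ M i j))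

-- sequences of n permutation matrices (the steps M_i - M_{i-1} of a lattice path)
stepSeqs : ℕ → List (List Mat)
stepSeqs zero = [ [] ]
stepSeqs (suc n) = concatMap (λ P → map (P ∷_) (stepSeqs n)) permMats

sumMats : List Mat → Mat
sumMats = foldr _⊕_ zeroMat

-- v(M): number of lattice paths 0 = M_0, …, M_ρ(M) = M with permutation-matrix steps;
-- a path is determined by its sequence of ρ(M) steps, whose sum must be M.
v : Mat → ℕ
v M = length (filter (λ ps → matEq? M (sumMats ps)) (stepSeqs (ρ M)))

-- Σ over M ∈ M(3) with ρ(M) = k and max(M) ≤ s of v(M) v(sJ - M)
-- (matrices with max(M) ≤ s all occur in matsBelow (s+1))
cutSum : ℕ → ℕ → ℕ
cutSum s k = sum (map (λ M → v M * v (sJ s ⊖ M))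
  (filter (λ M → maxEntry M ≤? s) (filter (semiMagicWith? k) (matsBelow (suc s)))))

{-# OPTIONS --safe #-}
-- Cutting a lattice path from 0 to sJ after k steps splits it into a path to the point M it has
-- reached, a semi-magic square of line sum k with M ≤ sJ entrywise (so max(M) ≤ s), and a sequence
-- of permutation matrices summing to sJ − M, i.e. a path to sJ − M; concatenation inverts this.
-- Grouping the paths to sJ by M gives the sum. All counts are sums of indicators over explicit
-- enumerations, and the grouping works because matsBelow (s + 1) lists every matrix with entries
-- ≤ s exactly once.
module Submission where

open import Defs
open import Data.Nat using (ℕ; zero; suc; _+_; _*_; _∸_; _≤_; _<_; _⊔_; s≤s; z≤n)
open import Data.Bool using (true; false; if_then_else_)
open import Data.Fin using (combine; remQuot)
open import Data.Fin.Properties using (remQuot-combine; combine-remQuot)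
open import Data.List
  using (List; []; _∷_; map; concatMap; filter; length; upTo; foldr; _++_; allFin; cartesianProduct)
open import Data.List.Membership.Propositional using (_∈_; find)
open import Data.List.Membership.Propositional.Properties
  using (∈-map⁻; ∈-concatMap⁻; ∈-filter⁻; ∈-allFin; ∈-cartesianProduct⁺)
open import Data.List.Properties using (map-++; map-∘; map-cong; map-upTo)
open import Data.List.Relation.Unary.All as All using (All; []; _∷_)
open import Data.List.Relation.Unary.Any using (here; there)
open import Data.Nat.ListAction using (sum)
open import Data.Nat.ListAction.Properties using (sum-++)
open import Data.Nat.Properties
open import Algebra.Properties.CommutativeSemigroup *-commutativeSemigroup
  using (x∙yz≈y∙xz)
open import Algebra.Properties.CommutativeSemigroup +-commutativeSemigroup
  using (interchange)
open import Data.Product using (_,_; proj₂; uncurry)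
open import Data.Vec using (Vec; []; _∷_; lookup; tabulate)
open import Data.Vec.Properties using (≡-dec; lookup∘tabulate; tabulate∘lookup; tabulate-cong)
open import Data.Vec.Relation.Unary.All using ([]; _∷_) renaming (All to AllV)
open import Data.Vec.Relation.Unary.All.Properties using (tabulate⁺)
open import Function using (_∘_)
open import Level using (Level)
open import Relation.Binary.PropositionalEquality
open import Relation.Nullary using (Dec; does; _because_; yes; no; ¬_; contradiction)
open import Relation.Nullary.Decidable using (_×-dec_)
open import Relation.Unary using (Pred; Decidable)

private variable
  a b p q : Level
  A : Set a
  B : Set b

∑ : List A → (A → ℕ) → ℕ
∑ xs f = sum (map f xs)

∑-cong : ∀ (xs : List A) {f g : A → ℕ} → (∀ x → f x ≡ g x) → ∑ xs f ≡ ∑ xs g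
∑-cong xs f≗g = cong sum (map-cong f≗g xs)

∑-cong-∈ : ∀ (xs : List A) {f g : A → ℕ} → (∀ {x} → x ∈ xs → f x ≡ g x) → ∑ xs f ≡ ∑ xs g
∑-cong-∈ []       eq = refl
∑-cong-∈ (x ∷ xs) eq = cong₂ _+_ (eq (here refl)) (∑-cong-∈ xs (eq ∘ there))

∑-zero : ∀ (xs : List A) → ∑ xs (λ _ → 0) ≡ 0
∑-zero []       = refl
∑-zero (x ∷ xs) = ∑-zero xs

∑-++ : ∀ (xs ys : List A) (f : A → ℕ) → ∑ (xs ++ ys) f ≡ ∑ xs f + ∑ ys f
∑-++ xs ys f = trans (cong sum (map-++ f xs ys)) (sum-++ (map f xs) (map f ys))

∑-map : ∀ (g : A → B) (xs : List A) (f : B → ℕ) → ∑ (map g xs) f ≡ ∑ xs (f ∘ g)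
∑-map g xs f = cong sum (sym (map-∘ xs))

∑-concatMap : ∀ (g : A → List B) (xs : List A) (f : B → ℕ) →
              ∑ (concatMap g xs) f ≡ ∑ xs (λ x → ∑ (g x) f)
∑-concatMap g []       f = refl
∑-concatMap g (x ∷ xs) f =
  trans (∑-++ (g x) (concatMap g xs) f) (cong (∑ (g x) f +_) (∑-concatMap g xs f))

∑-+ : ∀ (xs : List A) (f g : A → ℕ) → ∑ xs (λ x → f x + g x) ≡ ∑ xs f + ∑ xs g
∑-+ []       f g = refl
∑-+ (x ∷ xs) f g =
  trans (cong (f x + g x +_) (∑-+ xs f g)) (interchange (f x) (g x) (∑ xs f) (∑ xs g))

∑-comm : ∀ (xs : List A) (ys : List B) (f : A → B → ℕ) →
         ∑ xs (λ x → ∑ ys (f x)) ≡ ∑ ys (λ y → ∑ xs (λ x → f x y))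
∑-comm []       ys f = sym (∑-zero ys)
∑-comm (x ∷ xs) ys f =
  trans (cong (∑ ys (f x) +_) (∑-comm xs ys f)) (sym (∑-+ ys (f x) (λ y → ∑ xs (λ x′ → f x′ y))))

∑-∑-∑-rotate : ∀ {c} {C : Set c} (xs : List A) (ys : List B) (zs : List C) (f : A → B → C → ℕ) →
               ∑ xs (λ x → ∑ ys (λ y → ∑ zs (f x y))) ≡ ∑ zs (λ z → ∑ xs (λ x → ∑ ys (λ y → f x y z)))
∑-∑-∑-rotate xs ys zs f = trans (∑-cong xs (λ x → ∑-comm ys zs (f x))) (∑-comm xs zs _)

∑-*ˡ : ∀ (c : ℕ) (xs : List A) (f : A → ℕ) → c * ∑ xs f ≡ ∑ xs (λ x → c * f x)
∑-*ˡ c []       f = *-zeroʳ c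
∑-*ˡ c (x ∷ xs) f = trans (*-distribˡ-+ c (f x) (∑ xs f)) (cong (c * f x +_) (∑-*ˡ c xs f))

∑-*ʳ : ∀ (c : ℕ) (xs : List A) (f : A → ℕ) → ∑ xs f * c ≡ ∑ xs (λ x → f x * c)
∑-*ʳ c []       f = refl
∑-*ʳ c (x ∷ xs) f = trans (*-distribʳ-+ c (f x) (∑ xs f)) (cong (f x * c +_) (∑-*ʳ c xs f))

∑-*-∑ : ∀ (xs : List A) (ys : List B) (f : A → ℕ) (g : B → ℕ) →
        ∑ xs f * ∑ ys g ≡ ∑ xs (λ x → ∑ ys (λ y → f x * g y))
∑-*-∑ xs ys f g = trans (∑-*ʳ (∑ ys g) xs f) (∑-cong xs (λ x → ∑-*ˡ (f x) ys g))

*-∑-*-∑ : ∀ (c : ℕ) (xs : List A) (ys : List B) (f : A → ℕ) (g : B → ℕ) →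
          c * (∑ xs f * ∑ ys g) ≡ ∑ xs (λ x → ∑ ys (λ y → c * (f x * g y)))
*-∑-*-∑ c xs ys f g =
  trans (cong (c *_) (∑-*-∑ xs ys f g))
        (trans (∑-*ˡ c xs _) (∑-cong xs (λ x → ∑-*ˡ c ys (λ y → f x * g y))))

-- Defined through does, so that e.g. 𝟙 (suc m ≟ suc n) and 𝟙 (m ≟ n) agree definitionally.
𝟙 : {P : Set p} → Dec P → ℕ
𝟙 d = if does d then 1 else 0

𝟙-yes : {P : Set p} (d : Dec P) → P → 𝟙 d ≡ 1
𝟙-yes (yes _)  _  = refl
𝟙-yes (no ¬pf) pf = contradiction pf ¬pf

𝟙-no : {P : Set p} (d : Dec P) → ¬ P → 𝟙 d ≡ 0
𝟙-no (yes pf) ¬pf = contradiction pf ¬pf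
𝟙-no (no _)   _   = refl

𝟙-cong : {P : Set p} {Q : Set q} (d : Dec P) (e : Dec Q) → (P → Q) → (Q → P) → 𝟙 d ≡ 𝟙 e
𝟙-cong d (yes pf) P→Q Q→P = 𝟙-yes d (Q→P pf)
𝟙-cong d (no ¬pf) P→Q Q→P = 𝟙-no d (¬pf ∘ P→Q)

𝟙-char : ∀ {P : Set p} {n} (d : Dec P) → (P → n ≡ 1) → (¬ P → n ≡ 0) → 𝟙 d ≡ n
𝟙-char (yes pf) on off = sym (on pf)
𝟙-char (no ¬pf) on off = sym (off ¬pf)

𝟙-*-𝟙-*-cong : ∀ {P : Set p} {Q : Set q} {x y} (d : Dec P) (e : Dec Q) → (P → Q → x ≡ y) →
               𝟙 d * 𝟙 e * x ≡ 𝟙 d * 𝟙 e * y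
𝟙-*-𝟙-*-cong (yes pf) (yes qf) eq = cong (1 * 1 *_) (eq pf qf)
𝟙-*-𝟙-*-cong (yes _)  (no _)   eq = refl
𝟙-*-𝟙-*-cong (no _)   e        eq = refl

𝟙-×-dec : {P : Set p} {Q : Set q} (d : Dec P) (e : Dec Q) → 𝟙 (d ×-dec e) ≡ 𝟙 d * 𝟙 e
𝟙-×-dec (true  because _) e = sym (+-identityʳ (𝟙 e))
𝟙-×-dec (false because _) e = refl

∑-filter : {P : Pred A p} (P? : Decidable P) (xs : List A) (f : A → ℕ) →
           ∑ (filter P? xs) f ≡ ∑ xs (λ x → 𝟙 (P? x) * f x)
∑-filter P? []       f = refl
∑-filter P? (x ∷ xs) f with P? x
... | yes _ = cong₂ _+_ (sym (+-identityʳ (f x))) (∑-filter P? xs f)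
... | no  _ = ∑-filter P? xs f

length-filter-as-∑ : {P : Pred A p} (P? : Decidable P) (xs : List A) →
                length (filter P? xs) ≡ ∑ xs (λ x → 𝟙 (P? x))
length-filter-as-∑ P? []       = refl
length-filter-as-∑ P? (x ∷ xs) with P? x
... | yes _ = cong suc (length-filter-as-∑ P? xs)
... | no  _ = length-filter-as-∑ P? xs

∑-upTo-suc : ∀ n (f : ℕ → ℕ) → ∑ (upTo (suc n)) f ≡ f 0 + ∑ (upTo n) (f ∘ suc)
∑-upTo-suc n f = cong (f 0 +_) (trans (cong (λ ys → ∑ ys f) (sym (map-upTo suc n))) (∑-map suc (upTo n) f))

∑-upTo-select : ∀ {n x} (f : ℕ → ℕ) → x < n → ∑ (upTo n) (λ y → 𝟙 (y ≟ x) * f y) ≡ f x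
∑-upTo-select {suc n} {zero}  f _ =
  trans (∑-upTo-suc n (λ y → 𝟙 (y ≟ 0) * f y))
        (trans (cong (f 0 + 0 +_) (∑-zero (upTo n))) (trans (+-identityʳ _) (+-identityʳ (f 0))))
∑-upTo-select {suc n} {suc x} f (s≤s x<n) =
  trans (∑-upTo-suc n (λ y → 𝟙 (y ≟ suc x) * f y)) (∑-upTo-select (f ∘ suc) x<n)

_≟ᵥ_ : ∀ {n} (u w : Vec ℕ n) → Dec (u ≡ w)
_≟ᵥ_ = ≡-dec _≟_

∑-vecs-select : ∀ {b n} {u : Vec ℕ n} (g : Vec ℕ n → ℕ) → AllV (_< b) u →
                ∑ (vecs b n) (λ w → 𝟙 (w ≟ᵥ u) * g w) ≡ g u
∑-vecs-select {n = zero} {[]} g [] = trans (+-identityʳ _) (+-identityʳ (g []))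
∑-vecs-select {b} {suc n} {x ∷ u} g (x<b ∷ u<b) = begin
  ∑ (concatMap (λ y → map (y ∷_) (vecs b n)) (upTo b)) F
    ≡⟨ ∑-concatMap (λ y → map (y ∷_) (vecs b n)) (upTo b) F ⟩
  ∑ (upTo b) (λ y → ∑ (map (y ∷_) (vecs b n)) F)
    ≡⟨ ∑-cong (upTo b) (λ y → trans (∑-map (y ∷_) (vecs b n) F) (fibre y)) ⟩
  ∑ (upTo b) (λ y → 𝟙 (y ≟ x) * g (y ∷ u))
    ≡⟨ ∑-upTo-select (λ y → g (y ∷ u)) x<b ⟩
  g (x ∷ u) ∎
  where
  open ≡-Reasoning
  F : Vec ℕ (suc n) → ℕ
  F w = 𝟙 (w ≟ᵥ (x ∷ u)) * g w
  fibre : ∀ y → ∑ (vecs b n) (λ w → F (y ∷ w)) ≡ 𝟙 (y ≟ x) * g (y ∷ u)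
  fibre y = begin
    ∑ (vecs b n) (λ w → 𝟙 (y ≟ x ×-dec w ≟ᵥ u) * g (y ∷ w))
      ≡⟨ ∑-cong (vecs b n) (λ w → trans (cong (_* g (y ∷ w)) (𝟙-×-dec (y ≟ x) (w ≟ᵥ u)))
                                         (*-assoc (𝟙 (y ≟ x)) _ _)) ⟩
    ∑ (vecs b n) (λ w → 𝟙 (y ≟ x) * (𝟙 (w ≟ᵥ u) * g (y ∷ w)))
      ≡⟨ sym (∑-*ˡ (𝟙 (y ≟ x)) (vecs b n) _) ⟩
    𝟙 (y ≟ x) * ∑ (vecs b n) (λ w → 𝟙 (w ≟ᵥ u) * g (y ∷ w))
      ≡⟨ cong (𝟙 (y ≟ x) *_) (∑-vecs-select (λ w → g (y ∷ w)) u<b) ⟩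
    𝟙 (y ≟ x) * g (y ∷ u) ∎

_≐_ : Mat → Mat → Set
_≐_ = MatEq

𝟙-matEq?-resp : ∀ M {N N′} → N ≐ N′ → 𝟙 (matEq? M N) ≡ 𝟙 (matEq? M N′)
𝟙-matEq?-resp M {N} {N′} N≐N′ = 𝟙-cong (matEq? M N) (matEq? M N′)
  (λ eq i j → trans (eq i j) (N≐N′ i j)) (λ eq i j → trans (eq i j) (sym (N≐N′ i j)))

fromMat : Mat → Vec ℕ 9
fromMat M = tabulate (uncurry M ∘ remQuot 3)

toMat-fromMat : ∀ M → toMat (fromMat M) ≐ M
toMat-fromMat M i j =
  trans (lookup∘tabulate (uncurry M ∘ remQuot 3) (combine i j)) (cong (uncurry M) (remQuot-combine i j))

fromMat-toMat : ∀ w → fromMat (toMat w) ≡ w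
fromMat-toMat w =
  trans (tabulate-cong {f = uncurry (toMat w) ∘ remQuot 3} (cong (lookup w) ∘ combine-remQuot 3))
        (tabulate∘lookup w)

toMat≐⇒≡fromMat : ∀ {w M} → toMat w ≐ M → w ≡ fromMat M
toMat≐⇒≡fromMat {w} {M} eq =
  trans (sym (fromMat-toMat w))
        (tabulate-cong {f = uncurry (toMat w) ∘ remQuot 3} {g = uncurry M ∘ remQuot 3} (λ k → eq _ _))

≡fromMat⇒toMat≐ : ∀ {w M} → w ≡ fromMat M → toMat w ≐ M
≡fromMat⇒toMat≐ {M = M} refl = toMat-fromMat M

∑-matsBelow-select : ∀ {b c} {A : Mat} (H : Mat → ℕ) → (∀ i j → A i j < b) →
                     (∀ {M} → M ≐ A → H M ≡ c) →
                     ∑ (matsBelow b) (λ M → 𝟙 (matEq? M A) * H M) ≡ c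
∑-matsBelow-select {b} {c} {A} H A<b H≐ = begin
  ∑ (map toMat (vecs b 9)) (λ M → 𝟙 (matEq? M A) * H M)
    ≡⟨ ∑-map toMat (vecs b 9) _ ⟩
  ∑ (vecs b 9) (λ w → 𝟙 (matEq? (toMat w) A) * H (toMat w))
    ≡⟨ ∑-cong (vecs b 9) (λ w → cong (_* H (toMat w))
         (𝟙-cong (matEq? (toMat w) A) (w ≟ᵥ fromMat A) toMat≐⇒≡fromMat ≡fromMat⇒toMat≐)) ⟩
  ∑ (vecs b 9) (λ w → 𝟙 (w ≟ᵥ fromMat A) * H (toMat w))
    ≡⟨ ∑-vecs-select (H ∘ toMat) (tabulate⁺ {f = uncurry A ∘ remQuot 3} (λ k → A<b _ _)) ⟩
  H (toMat (fromMat A))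
    ≡⟨ H≐ (toMat-fromMat A) ⟩
  c ∎
  where open ≡-Reasoning

foldr-⊔-≤⁻ : ∀ (f : A → ℕ) xs {s} → foldr (λ x m → f x ⊔ m) 0 xs ≤ s → All (λ x → f x ≤ s) xs
foldr-⊔-≤⁻ f []       _  = []
foldr-⊔-≤⁻ f (x ∷ xs) le = m⊔n≤o⇒m≤o (f x) _ le ∷ foldr-⊔-≤⁻ f xs (m⊔n≤o⇒n≤o (f x) _ le)

foldr-⊔-≤⁺ : ∀ (f : A → ℕ) {xs s} → All (λ x → f x ≤ s) xs → foldr (λ x m → f x ⊔ m) 0 xs ≤ s
foldr-⊔-≤⁺ f []         = z≤n
foldr-⊔-≤⁺ f (le ∷ les) = ⊔-lub le (foldr-⊔-≤⁺ f les)

maxEntry≤⇒entries≤ : ∀ M {s} → maxEntry M ≤ s → ∀ i j → M i j ≤ s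
maxEntry≤⇒entries≤ M le i j =
  All.lookup (foldr-⊔-≤⁻ (uncurry M) _ le) (∈-cartesianProduct⁺ (∈-allFin i) (∈-allFin j))

entries≤⇒maxEntry≤ : ∀ M {s} → (∀ i j → M i j ≤ s) → maxEntry M ≤ s
entries≤⇒maxEntry≤ M {s} le = foldr-⊔-≤⁺ (uncurry M) {xs = cartesianProduct (allFin 3) (allFin 3)}
  (All.tabulate {P = λ c → uncurry M c ≤ s} (λ {(i , j)} _ → le i j))

semiMagic-resp-≐ : ∀ {k M N} → M ≐ N → SemiMagicWith k N → SemiMagicWith k M
semiMagic-resp-≐ M≐N (rows , cols) =
  (λ i → trans (cong₂ _+_ (cong₂ _+_ (M≐N i _) (M≐N i _)) (M≐N i _)) (rows i)) ,
  (λ j → trans (cong₂ _+_ (cong₂ _+_ (M≐N _ j) (M≐N _ j)) (M≐N _ j)) (cols j))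

semiMagic-⊕ : ∀ {m n M N} → SemiMagicWith m M → SemiMagicWith n N → SemiMagicWith (m + n) (M ⊕ N)
semiMagic-⊕ {M = M} {N} (rowsM , colsM) (rowsN , colsN) =
  (λ i → trans (regroup (M i _) (M i _) (M i _) (N i _) (N i _) (N i _)) (cong₂ _+_ (rowsM i) (rowsN i))) ,
  (λ j → trans (regroup (M _ j) (M _ j) (M _ j) (N _ j) (N _ j) (N _ j)) (cong₂ _+_ (colsM j) (colsN j)))
  where
  regroup : ∀ a b c x y z → a + x + (b + y) + (c + z) ≡ a + b + c + (x + y + z)
  regroup a b c x y z = trans (cong (_+ (c + z)) (interchange a x b y)) (interchange (a + b) (x + y) c z)

stepSeqs-semiMagic : ∀ n {ps} → ps ∈ stepSeqs n → SemiMagicWith n (sumMats ps)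
stepSeqs-semiMagic zero    (here refl) = (λ _ → refl) , (λ _ → refl)
stepSeqs-semiMagic (suc n) ps∈ with find (∈-concatMap⁻ (λ P → map (P ∷_) (stepSeqs n)) {xs = permMats} ps∈)
... | P , P∈ , ps∈P∷ with ∈-map⁻ (P ∷_) ps∈P∷
... | qs , qs∈ , refl = semiMagic-⊕ {M = P} {N = sumMats qs}
  (proj₂ (∈-filter⁻ (semiMagicWith? 1) {xs = matsBelow 2} P∈)) (stepSeqs-semiMagic n qs∈)

sumMats-++ : ∀ ps qs → sumMats (ps ++ qs) ≐ (sumMats ps ⊕ sumMats qs)
sumMats-++ []       qs i j = refl
sumMats-++ (P ∷ ps) qs i j = trans (cong (P i j +_) (sumMats-++ ps qs i j)) (sym (+-assoc (P i j) _ _))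

ρ-sJ : ∀ s → ρ (sJ s) ≡ 3 * s
ρ-sJ s = trans (+-assoc s s s) (cong (λ t → s + (s + t)) (sym (+-identityʳ s)))

[m∸n]+[o∸p]≡[m+o]∸[n+p] : ∀ {m n o p} → n ≤ m → p ≤ o → (m ∸ n) + (o ∸ p) ≡ (m + o) ∸ (n + p)
[m∸n]+[o∸p]≡[m+o]∸[n+p] {m} {n} {o} {p} n≤m p≤o = sym (begin
  (m + o) ∸ (n + p)   ≡⟨ sym (∸-+-assoc (m + o) n p) ⟩
  (m + o) ∸ n ∸ p     ≡⟨ cong (_∸ p) (+-∸-comm o n≤m) ⟩
  (m ∸ n) + o ∸ p     ≡⟨ +-∸-assoc (m ∸ n) p≤o ⟩
  (m ∸ n) + (o ∸ p)   ∎)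
  where open ≡-Reasoning

ρ-sJ⊖ : ∀ {s M} → (∀ i j → M i j ≤ s) → ρ (sJ s ⊖ M) ≡ ρ (sJ s) ∸ ρ M
ρ-sJ⊖ M≤s = trans (cong₂ _+_ ([m∸n]+[o∸p]≡[m+o]∸[n+p] (M≤s _ _) (M≤s _ _)) refl)
                  ([m∸n]+[o∸p]≡[m+o]∸[n+p] (+-mono-≤ (M≤s _ _) (M≤s _ _)) (M≤s _ _))

v-as-∑ : ∀ M {n} → ρ M ≡ n → v M ≡ ∑ (stepSeqs n) (λ ps → 𝟙 (matEq? M (sumMats ps)))
v-as-∑ M refl = length-filter-as-∑ (λ ps → matEq? M (sumMats ps)) (stepSeqs (ρ M))

∑-stepSeqs-+ : ∀ m n (g : List Mat → ℕ) →
               ∑ (stepSeqs (m + n)) g ≡ ∑ (stepSeqs m) (λ ps → ∑ (stepSeqs n) (λ qs → g (ps ++ qs)))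
∑-stepSeqs-+ zero    n g = sym (+-identityʳ _)
∑-stepSeqs-+ (suc m) n g = begin
  ∑ (concatMap (λ P → map (P ∷_) (stepSeqs (m + n))) permMats) g
    ≡⟨ ∑-concatMap (λ P → map (P ∷_) (stepSeqs (m + n))) permMats g ⟩
  ∑ permMats (λ P → ∑ (map (P ∷_) (stepSeqs (m + n))) g)
    ≡⟨ ∑-cong permMats (λ P → trans (∑-map (P ∷_) (stepSeqs (m + n)) g) (∑-stepSeqs-+ m n (g ∘ (P ∷_)))) ⟩
  ∑ permMats (λ P → ∑ (stepSeqs m) (λ ps → G (P ∷ ps)))
    ≡⟨ ∑-cong permMats (λ P → sym (∑-map (P ∷_) (stepSeqs m) G)) ⟩
  ∑ permMats (λ P → ∑ (map (P ∷_) (stepSeqs m)) G)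
    ≡⟨ sym (∑-concatMap (λ P → map (P ∷_) (stepSeqs m)) permMats G) ⟩
  ∑ (concatMap (λ P → map (P ∷_) (stepSeqs m)) permMats) G ∎
  where
  open ≡-Reasoning
  G : List Mat → ℕ
  G ps = ∑ (stepSeqs n) (λ qs → g (ps ++ qs))

cutWeight : ℕ → ℕ → Mat → ℕ
cutWeight s k M = 𝟙 (maxEntry M ≤? s) * 𝟙 (semiMagicWith? k M)

cutSum-as-∑ : ∀ s k → cutSum s k ≡ ∑ (matsBelow (suc s)) (λ M → cutWeight s k M * (v M * v (sJ s ⊖ M)))
cutSum-as-∑ s k =
  trans (∑-filter (λ M → maxEntry M ≤? s) (filter (semiMagicWith? k) L) f)
  (trans (∑-filter (semiMagicWith? k) L (λ M → 𝟙 (maxEntry M ≤? s) * f M))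
         (∑-cong L (λ M → trans (x∙yz≈y∙xz (𝟙 (semiMagicWith? k M)) (𝟙 (maxEntry M ≤? s)) (f M))
                                (sym (*-assoc (𝟙 (maxEntry M ≤? s)) (𝟙 (semiMagicWith? k M)) (f M))))))
  where
  L = matsBelow (suc s)
  f : Mat → ℕ
  f M = v M * v (sJ s ⊖ M)

sJ≐⊕-as-∑ : ∀ s {k} A B → SemiMagicWith k A →
            𝟙 (matEq? (sJ s) (A ⊕ B)) ≡
            ∑ (matsBelow (suc s)) (λ M → cutWeight s k M * (𝟙 (matEq? M A) * 𝟙 (matEq? (sJ s ⊖ M) B)))
sJ≐⊕-as-∑ s {k} A B smA = 𝟙-char (matEq? (sJ s) (A ⊕ B)) on-split off-split
  where
  on-split : sJ s ≐ (A ⊕ B) → _ ≡ 1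
  on-split sJ≐A⊕B =
    trans (∑-cong (matsBelow (suc s)) (λ M → x∙yz≈y∙xz (cutWeight s k M) (𝟙 (matEq? M A)) _))
          (∑-matsBelow-select H (λ i j → s≤s (A≤s i j)) H≡1)
    where
    A≤s : ∀ i j → A i j ≤ s
    A≤s i j = subst (A i j ≤_) (sym (sJ≐A⊕B i j)) (m≤m+n (A i j) (B i j))
    H : Mat → ℕ
    H M = cutWeight s k M * 𝟙 (matEq? (sJ s ⊖ M) B)
    H≡1 : ∀ {M} → M ≐ A → H M ≡ 1
    H≡1 {M} M≐A = cong₂ _*_
      (cong₂ _*_
        (𝟙-yes (maxEntry M ≤? s) (entries≤⇒maxEntry≤ M (λ i j → subst (_≤ s) (sym (M≐A i j)) (A≤s i j))))
        (𝟙-yes (semiMagicWith? k M) (semiMagic-resp-≐ M≐A smA)))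
      (𝟙-yes (matEq? (sJ s ⊖ M) B)
             (λ i j → trans (cong₂ _∸_ (sJ≐A⊕B i j) (M≐A i j)) (m+n∸m≡n (A i j) (B i j))))
  off-split : ¬ sJ s ≐ (A ⊕ B) → _ ≡ 0
  off-split sJ≉A⊕B = trans (∑-cong (matsBelow (suc s)) vanish) (∑-zero (matsBelow (suc s)))
    where
    vanish : ∀ M → cutWeight s k M * (𝟙 (matEq? M A) * 𝟙 (matEq? (sJ s ⊖ M) B)) ≡ 0
    vanish M = go (maxEntry M ≤? s) (matEq? M A) (matEq? (sJ s ⊖ M) B)
      where
      go : (d₁ : Dec (maxEntry M ≤ s)) (d₂ : Dec (M ≐ A)) (d₃ : Dec ((sJ s ⊖ M) ≐ B)) →
           𝟙 d₁ * 𝟙 (semiMagicWith? k M) * (𝟙 d₂ * 𝟙 d₃) ≡ 0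
      go (no  _)   _         _            = refl
      go (yes _)   (no _)    _            = *-zeroʳ (1 * 𝟙 (semiMagicWith? k M))
      go (yes _)   (yes _)   (no _)       = *-zeroʳ (1 * 𝟙 (semiMagicWith? k M))
      go (yes M≤s) (yes M≐A) (yes sJ⊖M≐B) = contradiction
        (λ i j → sym (trans (cong₂ _+_ (sym (M≐A i j)) (sym (sJ⊖M≐B i j)))
                            (m+[n∸m]≡n (maxEntry≤⇒entries≤ M M≤s i j))))
        sJ≉A⊕B

v*v-on-cut : ∀ s k M →
  cutWeight s k M * (v M * v (sJ s ⊖ M)) ≡
  cutWeight s k M * (∑ (stepSeqs k) (λ ps → 𝟙 (matEq? M (sumMats ps))) *
                     ∑ (stepSeqs (3 * s ∸ k)) (λ qs → 𝟙 (matEq? (sJ s ⊖ M) (sumMats qs))))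
v*v-on-cut s k M = 𝟙-*-𝟙-*-cong (maxEntry M ≤? s) (semiMagicWith? k M) λ M≤s (rows , _) →
  cong₂ _*_ (v-as-∑ M (rows _))
            (v-as-∑ (sJ s ⊖ M) (trans (ρ-sJ⊖ (maxEntry≤⇒entries≤ M M≤s)) (cong₂ _∸_ (ρ-sJ s) (rows _))))

corollary6p2 : (s k : ℕ) → k ≤ 3 * s → v (sJ s) ≡ cutSum s k
corollary6p2 s k k≤3s = begin
  v (sJ s)
    ≡⟨ v-as-∑ (sJ s) (trans (ρ-sJ s) (sym (m+[n∸m]≡n k≤3s))) ⟩
  ∑ (stepSeqs (k + m)) (λ rs → 𝟙 (matEq? (sJ s) (σ rs)))
    ≡⟨ ∑-stepSeqs-+ k m (λ rs → 𝟙 (matEq? (sJ s) (σ rs))) ⟩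
  ∑ (stepSeqs k) (λ ps → ∑ (stepSeqs m) (λ qs → 𝟙 (matEq? (sJ s) (σ (ps ++ qs)))))
    ≡⟨ ∑-cong-∈ (stepSeqs k) (λ {ps} ps∈ → ∑-cong (stepSeqs m) (λ qs →
         trans (𝟙-matEq?-resp (sJ s) (sumMats-++ ps qs))
               (sJ≐⊕-as-∑ s (σ ps) (σ qs) (stepSeqs-semiMagic k ps∈)))) ⟩
  ∑ (stepSeqs k) (λ ps → ∑ (stepSeqs m) (λ qs → ∑ L (λ M → w M * (reaches M ps * completes M qs))))
    ≡⟨ ∑-∑-∑-rotate (stepSeqs k) (stepSeqs m) L _ ⟩
  ∑ L (λ M → ∑ (stepSeqs k) (λ ps → ∑ (stepSeqs m) (λ qs → w M * (reaches M ps * completes M qs))))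
    ≡⟨ ∑-cong L (λ M → sym (*-∑-*-∑ (w M) (stepSeqs k) (stepSeqs m) (reaches M) (completes M))) ⟩
  ∑ L (λ M → w M * (∑ (stepSeqs k) (reaches M) * ∑ (stepSeqs m) (completes M)))
    ≡⟨ ∑-cong L (λ M → sym (v*v-on-cut s k M)) ⟩
  ∑ L (λ M → w M * (v M * v (sJ s ⊖ M)))
    ≡⟨ sym (cutSum-as-∑ s k) ⟩
  cutSum s k ∎
  where
  open ≡-Reasoning
  m = 3 * s ∸ k
  L = matsBelow (suc s)
  σ = sumMats
  w = cutWeight s k
  reaches completes : Mat → List Mat → ℕ
  reaches M ps = 𝟙 (matEq? M (σ ps))
  completes M qs = 𝟙 (matEq? (sJ s ⊖ M) (σ qs))
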